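{- Let $n\ge 1$ be fixed and let $S$ be a set with $n$ elements. Define $\wp_n^{(1)}$ to be the set of all partitions of $S$, and for $m>1$ define $\wp_n^{(m)}$ to be the union, over all $p\in\wp_n^{(m-1)}$, of the set of all partitions of the set $p$ (regarding $p$ as the set of its blocks). For $m,k\ge1$ let $S^{(m)}(n,k)$ be the number of elements of $\wp_n^{(m)}$ having exactly $k$ elements, and let $B_n^{(m)}=|\wp_n^{(m)}|=\sum_{k=1}^n S^{(m)}(n,k)$. Let $$A_n^{(m)}=\frac{1}{B_n^{(m)}}\sum_{k=1}^n k\,S^{(m)}(n,k)$$ be the average cardinality of the elements of $\wp_n^{(m)}$. Then $A_n^{(m)}\to 1$ as $m\to\infty$.
   Context: $B_n^{(m)}$ coincides with the $m$-th order Bell number, i.e. $n!$ times the coefficient of $x^n$ in $E_m(x)$, where $E_1(x)=\exp(e^x-1)$ and $E_{m+1}(x)=\exp(E_m(x)-1)$. -}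

module Defs where

open import Data.Nat using (ℕ; zero; suc; _+_; _*_; _⊔_; _≤_)
open import Data.Nat.Properties using (_≟_)
open import Data.List using (List; []; _∷_; _++_; [_]; map; concatMap; upTo; filter; length)
open import Data.Nat.ListAction using (sum)
open import Data.Integer using (+_)
open import Data.Rational using (ℚ; _/_; 0ℚ)

-- A set partition of the n-element set {0,…,n-1} is encoded canonically as a
-- restricted growth string (RGS) a₀ … a_{n-1}: a_i is the index of the block of i,
-- blocks numbered 0,1,2,… in order of their least element.
-- This is a bijective encoding of the set of all partitions.

blocks : List ℕ → ℕ
blocks [] = 0
blocks (x ∷ xs) = suc x ⊔ blocks xs

parts : ℕ → List (List ℕ)
parts zero = [] ∷ []
parts (suc n) = concatMap (λ s → map (λ i → s ++ [ i ]) (upTo (suc (blocks s)))) (parts n)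

-- An element of ℘_n^{(m)} is determined by the chain p₁, p₂, …, p_m where p₁ is a
-- partition of S and p_{j+1} is a partition of the set of blocks of p_j (these
-- blocks being identified with {0,…,blocks p_j - 1} via the canonical numbering).
-- Chains are stored most-recent-first.  The union defining ℘^{(m)} is disjoint
-- (a partition of p determines p), so ℘^{(m)} is in bijection with such chains.
Chain : Set
Chain = List (List ℕ)

card : Chain → ℕ
card [] = 0
card (p ∷ _) = blocks p

-- ℘ n (suc m) enumerates ℘_n^{(m+1)};  ℘ n 0 is unused (empty)
℘ : ℕ → ℕ → List Chain
℘ n zero = []
℘ n (suc zero) = map (λ p → p ∷ []) (parts n)
℘ n (suc (suc m)) = concatMap (λ c → map (λ q → q ∷ c) (parts (card c))) (℘ n (suc m))

S : ℕ → ℕ → ℕ → ℕ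
S m n k = length (filter (λ c → card c ≟ k) (℘ n m))

B : ℕ → ℕ → ℕ
B m n = length (℘ n m)

weighted : ℕ → ℕ → ℕ
weighted m n = sum (map (λ k → k * S m n k) (map suc (upTo n)))

-- A_n^{(m)} as a rational (B is always positive for n ≥ 1, m ≥ 1; the 0 case is a
-- totality default that never occurs)
A : ℕ → ℕ → ℚ
A m n with B m n
... | zero = 0ℚ
... | suc b = (+ weighted m n) / suc b

{-# OPTIONS --safe #-}
-- Write Bₘ = B_n^{(m)}.  Then Bₘ₊₁ (A_n^{(m+1)} - 1) is the number Tₘ of pairs
-- (element p of ℘^{(m+1)}, block of p other than the first), and Tₘ is at most
-- Dₘ = Bₘ₊₂ - Bₘ₊₁, the number of elements of ℘^{(m+2)} whose last partition is not
-- the discrete one, because a k-set has at least k partitions.  Let G(j, m) count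
-- the elements of ℘^{(m+1+j)} whose last j partitions are all non-discrete.  Looking
-- at the partition taken right after ℘^{(m+1)} gives the Pascal recurrence
-- G(j, m+1) = G(j, m) + G(j+1, m), and G(j, m) = 0 for j > n since each non-discrete
-- partition has fewer blocks than the set it partitions.  These two facts alone force
-- m G(1, m) ≤ n G(0, m+1), i.e. m Dₘ ≤ n (Bₘ₊₁ + Dₘ), so A_n^{(m+1)} - 1 ≤ n / (m - n).
module Submission where

open import Defs
open import Data.Nat as ℕ using (ℕ; zero; suc; pred; _+_; _*_; _∸_; _⊔_; _≤_; z≤n; s≤s; z<s)
open import Data.Nat.Properties
open import Data.Nat.ListAction using (sum)
open import Data.Nat.ListAction.Properties using (sum-++)
open import Data.Nat.Tactic.RingSolver using (solve-∀)
open import Algebra.Properties.CommutativeSemigroup +-commutativeSemigroup using (interchange)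
open import Data.Bool using (true; false; if_then_else_)
open import Data.List using (List; []; _∷_; _++_; [_]; map; concatMap; upTo; filter; length)
open import Data.List.Properties using (map-++; map-∘; map-cong; map-applyUpTo; upTo-∷ʳ)
open import Data.Product using (∃; _,_)
open import Function using (id; _∘_)
open import Relation.Nullary using (does; yes; no)
open import Relation.Nullary.Decidable using (dec-false)
open import Relation.Binary.PropositionalEquality hiding ([_])
open import Data.Integer as ℤ using (-[1+_]; +<+)
open import Data.Integer.Properties using (pos-+; pos-*)
import Data.Integer.Tactic.RingSolver as ℤ-Solver
open import Data.Rational as ℚ using (ℚ; mkℚ; _<_; _-_; ∣_∣; 0ℚ; 1ℚ; toℚᵘ; *<*)
open import Data.Rational.Properties
  using (toℚᵘ-injective; toℚᵘ-fromℚᵘ; toℚᵘ-homo-+; toℚᵘ-homo‿-; toℚᵘ-cancel-<;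
         normalize-nonNeg; nonNegative⁻¹; 0≤p⇒∣p∣≡p)
open import Data.Rational.Unnormalised as ℚᵘ using (mkℚᵘ; _≃_; *≡*)
open import Data.Rational.Unnormalised.Properties using (≃-sym; ≃-trans; +-cong; <-respˡ-≃)

variable
  X Y : Set

∑ : (X → ℕ) → List X → ℕ
∑ g xs = sum (map g xs)

∑-++ : ∀ (g : X → ℕ) xs ys → ∑ g (xs ++ ys) ≡ ∑ g xs + ∑ g ys
∑-++ g xs ys = trans (cong sum (map-++ g xs ys)) (sum-++ (map g xs) (map g ys))

∑-concatMap : ∀ (g : Y → ℕ) (f : X → List Y) xs → ∑ g (concatMap f xs) ≡ ∑ (∑ g ∘ f) xs
∑-concatMap g f [] = refl
∑-concatMap g f (x ∷ xs) =
  trans (∑-++ g (f x) (concatMap f xs)) (cong (∑ g (f x) +_) (∑-concatMap g f xs))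

∑-map : ∀ (g : Y → ℕ) (f : X → Y) xs → ∑ g (map f xs) ≡ ∑ (g ∘ f) xs
∑-map g f xs = cong sum (sym (map-∘ xs))

∑-cong : ∀ {g h : X → ℕ} → (∀ x → g x ≡ h x) → ∀ xs → ∑ g xs ≡ ∑ h xs
∑-cong g≗h xs = cong sum (map-cong g≗h xs)

∑-mono-≤ : ∀ {g h : X → ℕ} → (∀ x → g x ≤ h x) → ∀ xs → ∑ g xs ≤ ∑ h xs
∑-mono-≤ g≤h [] = z≤n
∑-mono-≤ g≤h (x ∷ xs) = +-mono-≤ (g≤h x) (∑-mono-≤ g≤h xs)

∑-zero : (xs : List X) → ∑ (λ _ → 0) xs ≡ 0
∑-zero [] = refl
∑-zero (x ∷ xs) = ∑-zero xs

∑-distrib-+ : ∀ (g h : X → ℕ) xs → ∑ (λ x → g x + h x) xs ≡ ∑ g xs + ∑ h xs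
∑-distrib-+ g h [] = refl
∑-distrib-+ g h (x ∷ xs) =
  trans (cong (g x + h x +_) (∑-distrib-+ g h xs)) (interchange (g x) (h x) (∑ g xs) (∑ h xs))

∑-*-distribˡ : ∀ k (g : X → ℕ) xs → ∑ (λ x → k * g x) xs ≡ k * ∑ g xs
∑-*-distribˡ k g [] = sym (*-zeroʳ k)
∑-*-distribˡ k g (x ∷ xs) =
  trans (cong (k * g x +_) (∑-*-distribˡ k g xs)) (sym (*-distribˡ-+ k (g x) (∑ g xs)))

∑-comm : ∀ (f : X → Y → ℕ) xs ys → ∑ (λ x → ∑ (f x) ys) xs ≡ ∑ (λ y → ∑ (λ x → f x y) xs) ys
∑-comm f [] ys = sym (∑-zero ys)
∑-comm f (x ∷ xs) ys =
  trans (cong (∑ (f x) ys +_) (∑-comm f xs ys)) (sym (∑-distrib-+ (f x) _ ys))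

∑-upTo-∷ : ∀ (g : ℕ → ℕ) n → ∑ g (upTo (suc n)) ≡ g 0 + ∑ (g ∘ suc) (upTo n)
∑-upTo-∷ g n =
  cong (g 0 +_) (trans (cong (∑ g) (sym (map-applyUpTo id suc n))) (∑-map g suc (upTo n)))

∑-upTo-∷ʳ : ∀ (g : ℕ → ℕ) n → ∑ g (upTo (suc n)) ≡ ∑ g (upTo n) + g n
∑-upTo-∷ʳ g n = trans (cong (∑ g) (sym (upTo-∷ʳ n)))
  (trans (∑-++ g (upTo n) [ n ]) (cong (∑ g (upTo n) +_) (+-identityʳ (g n))))

length≡∑1 : (xs : List X) → length xs ≡ ∑ (λ _ → 1) xs
length≡∑1 [] = refl
length≡∑1 (x ∷ xs) = cong suc (length≡∑1 xs)

δ : ℕ → ℕ → ℕ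
δ x k = if does (x ≟ k) then 1 else 0

length-filter≡∑δ : ∀ (f : X → ℕ) k xs →
  length (filter (λ x → f x ≟ k) xs) ≡ ∑ (λ x → δ (f x) k) xs
length-filter≡∑δ f k [] = refl
length-filter≡∑δ f k (x ∷ xs) with does (f x ≟ k)
... | true = cong suc (length-filter≡∑δ f k xs)
... | false = length-filter≡∑δ f k xs

δ-≢ : ∀ {x k} → x ≢ k → δ x k ≡ 0
δ-≢ {x} {k} x≢k = cong (if_then 1 else 0) (dec-false (x ≟ k) x≢k)

*-δ : ∀ x k → k * δ x k ≡ x * δ x k
*-δ x k with x ≟ k
... | yes refl = refl
... | no x≢k rewrite δ-≢ x≢k = trans (*-zeroʳ k) (sym (*-zeroʳ x))

∑-upTo-δ : ∀ {y n} → y ℕ.< n → ∑ (δ y) (upTo n) ≡ 1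
∑-upTo-δ {zero} {suc n} _ = trans (∑-upTo-∷ (δ 0) n) (cong suc (∑-zero (upTo n)))
∑-upTo-δ {suc y} {suc n} (s≤s y<n) = trans (∑-upTo-∷ (δ (suc y)) n) (∑-upTo-δ y<n)

∑-*-δ : ∀ {x n} → 1 ≤ x → x ≤ n → ∑ (λ k → k * δ x k) (map suc (upTo n)) ≡ x
∑-*-δ {suc y} {n} _ y<n = begin
  ∑ (λ k → k * δ (suc y) k) (map suc (upTo n)) ≡⟨ ∑-map _ suc (upTo n) ⟩
  ∑ (λ i → suc i * δ y i) (upTo n)              ≡⟨ ∑-cong (λ i → *-δ (suc y) (suc i)) (upTo n) ⟩
  ∑ (λ i → suc y * δ y i) (upTo n)              ≡⟨ ∑-*-distribˡ (suc y) (δ y) (upTo n) ⟩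
  suc y * ∑ (δ y) (upTo n)                      ≡⟨ cong (suc y *_) (∑-upTo-δ y<n) ⟩
  suc y * 1                                     ≡⟨ *-identityʳ (suc y) ⟩
  suc y                                         ∎
  where open ≡-Reasoning

blocks-∷ʳ : ∀ s i → blocks (s ++ [ i ]) ≡ blocks s ⊔ suc i
blocks-∷ʳ [] i = ⊔-identityʳ (suc i)
blocks-∷ʳ (x ∷ s) i =
  trans (cong (suc x ⊔_) (blocks-∷ʳ s i)) (sym (⊔-assoc (suc x) (blocks s) (suc i)))

∑-upTo-⊔ : ∀ (g : ℕ → ℕ) {b} c → c ≤ b → ∑ (λ i → g (b ⊔ suc i)) (upTo c) ≡ c * g b
∑-upTo-⊔ g zero _ = refl
∑-upTo-⊔ g {b} (suc c) c<b = begin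
  ∑ (λ i → g (b ⊔ suc i)) (upTo (suc c)) ≡⟨ ∑-upTo-∷ʳ _ c ⟩
  ∑ (λ i → g (b ⊔ suc i)) (upTo c) + g (b ⊔ suc c)
    ≡⟨ cong₂ _+_ (∑-upTo-⊔ g c (<⇒≤ c<b)) (cong g (m≥n⇒m⊔n≡m c<b)) ⟩
  c * g b + g b                          ≡⟨ +-comm (c * g b) (g b) ⟩
  suc c * g b                            ∎
  where open ≡-Reasoning

partSum : (ℕ → ℕ) → ℕ → ℕ
partSum g k = ∑ (g ∘ blocks) (parts k)

partSum-suc : ∀ g k → partSum g (suc k) ≡ partSum (λ b → b * g b) k + partSum (g ∘ suc) k
partSum-suc g k = begin
  partSum g (suc k)
    ≡⟨ ∑-concatMap (g ∘ blocks) extensions (parts k) ⟩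
  ∑ (∑ (g ∘ blocks) ∘ extensions) (parts k)
    ≡⟨ ∑-cong ∑-extensions (parts k) ⟩
  ∑ (λ s → blocks s * g (blocks s) + g (suc (blocks s))) (parts k)
    ≡⟨ ∑-distrib-+ _ _ (parts k) ⟩
  partSum (λ b → b * g b) k + partSum (g ∘ suc) k
    ∎
  where
  open ≡-Reasoning
  extensions : List ℕ → List (List ℕ)
  extensions s = map (λ i → s ++ [ i ]) (upTo (suc (blocks s)))
  ∑-extensions : ∀ s → ∑ (g ∘ blocks) (extensions s) ≡ blocks s * g (blocks s) + g (suc (blocks s))
  ∑-extensions s = begin
    ∑ (g ∘ blocks) (extensions s)
      ≡⟨ ∑-map (g ∘ blocks) (λ i → s ++ [ i ]) (upTo (suc b)) ⟩
    ∑ (λ i → g (blocks (s ++ [ i ]))) (upTo (suc b))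
      ≡⟨ ∑-cong (λ i → cong g (blocks-∷ʳ s i)) (upTo (suc b)) ⟩
    ∑ (λ i → g (b ⊔ suc i)) (upTo (suc b))
      ≡⟨ ∑-upTo-∷ʳ _ b ⟩
    ∑ (λ i → g (b ⊔ suc i)) (upTo b) + g (b ⊔ suc b)
      ≡⟨ cong₂ _+_ (∑-upTo-⊔ g b ≤-refl) (cong g (m≤n⇒m⊔n≡n (n≤1+n b))) ⟩
    b * g b + g (suc b)
      ∎
    where
    b : ℕ
    b = blocks s

≤-partSum : ∀ g k → g k ≤ partSum g k
≤-partSum g zero = m≤m+n (g 0) 0
≤-partSum g (suc k) rewrite partSum-suc g k = ≤-trans (≤-partSum (g ∘ suc) k) (m≤n+m _ _)

partSum-≤ : ∀ g k → (∀ x → x ℕ.< k → g x ≡ 0) → partSum g k ≤ g k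
partSum-≤ g zero _ = ≤-reflexive (+-identityʳ (g 0))
partSum-≤ g (suc k) g<k≡0 rewrite partSum-suc g k =
  +-mono-≤ (≤-trans (partSum-≤ (λ b → b * g b) k x*gx≡0) (≤-reflexive k*gk≡0))
           (partSum-≤ (g ∘ suc) k (λ x x<k → g<k≡0 (suc x) (s≤s x<k)))
  where
  k*gk≡0 : k * g k ≡ 0
  k*gk≡0 = trans (cong (k *_) (g<k≡0 k ≤-refl)) (*-zeroʳ k)
  x*gx≡0 : ∀ x → x ℕ.< k → x * g x ≡ 0
  x*gx≡0 x x<k = trans (cong (x *_) (g<k≡0 x (m<n⇒m<1+n x<k))) (*-zeroʳ x)

partSum-cong : ∀ {g h} k → (∀ y → y ≤ k → g y ≡ h y) → partSum g k ≡ partSum h k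
partSum-cong zero g≗h = cong (_+ 0) (g≗h 0 z≤n)
partSum-cong {g} {h} (suc k) g≗h = begin
  partSum g (suc k)                               ≡⟨ partSum-suc g k ⟩
  partSum (λ b → b * g b) k + partSum (g ∘ suc) k
    ≡⟨ cong₂ _+_ (partSum-cong k (λ y y≤k → cong (y *_) (g≗h y (m≤n⇒m≤1+n y≤k))))
                 (partSum-cong k (λ y y≤k → g≗h (suc y) (s≤s y≤k))) ⟩
  partSum (λ b → b * h b) k + partSum (h ∘ suc) k ≡⟨ partSum-suc h k ⟨
  partSum h (suc k)                               ∎
  where open ≡-Reasoning

partSum-cong⁺ : ∀ {g h} k → (∀ y → 1 ≤ y → y ≤ suc k → g y ≡ h y) →
  partSum g (suc k) ≡ partSum h (suc k)
partSum-cong⁺ {g} {h} k g≗h = begin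
  partSum g (suc k)                               ≡⟨ partSum-suc g k ⟩
  partSum (λ b → b * g b) k + partSum (g ∘ suc) k
    ≡⟨ cong₂ _+_ (partSum-cong k (λ y y≤k → *-agree y (m≤n⇒m≤1+n y≤k)))
                 (partSum-cong k (λ y y≤k → g≗h (suc y) (s≤s z≤n) (s≤s y≤k))) ⟩
  partSum (λ b → b * h b) k + partSum (h ∘ suc) k ≡⟨ partSum-suc h k ⟨
  partSum h (suc k)                               ∎
  where
  open ≡-Reasoning
  *-agree : ∀ y → y ≤ suc k → y * g y ≡ y * h y
  *-agree zero _ = refl
  *-agree (suc y) 1+y≤1+k = cong (suc y *_) (g≗h (suc y) (s≤s z≤n) 1+y≤1+k)

bell : ℕ → ℕ
bell = partSum (λ _ → 1)

n≤bell : ∀ n → n ≤ bell n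
n≤bell zero = z≤n
n≤bell (suc n) = begin
  suc n                             ≡⟨ +-comm 1 n ⟩
  n + 1                             ≡⟨ cong (_+ 1) (*-identityʳ n) ⟨
  n * 1 + 1                         ≤⟨ +-mono-≤ (≤-partSum (λ b → b * 1) n) (≤-partSum (λ _ → 1) n) ⟩
  partSum (λ b → b * 1) n + bell n  ≡⟨ partSum-suc (λ _ → 1) n ⟨
  bell (suc n)                      ∎
  where open ≤-Reasoning

chainSum : ℕ → ℕ → (ℕ → ℕ) → ℕ
chainSum n m g = ∑ (g ∘ card) (℘ n (suc m))

chainSum-zero : ∀ n g → chainSum n 0 g ≡ partSum g n
chainSum-zero n g = ∑-map (g ∘ card) (λ p → p ∷ []) (parts n)

chainSum-suc : ∀ n m g → chainSum n (suc m) g ≡ chainSum n m (partSum g)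
chainSum-suc n m g =
  trans (∑-concatMap (g ∘ card) (λ c → map (_∷ c) (parts (card c))) (℘ n (suc m)))
        (∑-cong (λ c → ∑-map (g ∘ card) (_∷ c) (parts (card c))) (℘ n (suc m)))

≤-chainSum : ∀ n m g → g n ≤ chainSum n m g
≤-chainSum n zero g = subst (g n ≤_) (sym (chainSum-zero n g)) (≤-partSum g n)
≤-chainSum n (suc m) g = subst (g n ≤_) (sym (chainSum-suc n m g))
  (≤-trans (≤-partSum g n) (≤-chainSum n m (partSum g)))

chainSum-cong : ∀ N m {g h} → (∀ y → 1 ≤ y → y ≤ suc N → g y ≡ h y) →
  chainSum (suc N) m g ≡ chainSum (suc N) m h
chainSum-cong N zero {g} {h} g≗h = begin
  chainSum (suc N) 0 g ≡⟨ chainSum-zero (suc N) g ⟩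
  partSum g (suc N)    ≡⟨ partSum-cong⁺ N g≗h ⟩
  partSum h (suc N)    ≡⟨ chainSum-zero (suc N) h ⟨
  chainSum (suc N) 0 h ∎
  where open ≡-Reasoning
chainSum-cong N (suc m) {g} {h} g≗h = begin
  chainSum (suc N) (suc m) g     ≡⟨ chainSum-suc (suc N) m g ⟩
  chainSum (suc N) m (partSum g) ≡⟨ chainSum-cong N m partSum-agree ⟩
  chainSum (suc N) m (partSum h) ≡⟨ chainSum-suc (suc N) m h ⟨
  chainSum (suc N) (suc m) h     ∎
  where
  open ≡-Reasoning
  partSum-agree : ∀ y → 1 ≤ y → y ≤ suc N → partSum g y ≡ partSum h y
  partSum-agree (suc y) _ 1+y≤1+N =
    partSum-cong⁺ y (λ z 1≤z z≤1+y → g≗h z 1≤z (≤-trans z≤1+y 1+y≤1+N))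

-- The discrete partition is the only one with k blocks, so this sums g over the
-- non-discrete partitions of a k-set.
properPartSum : (ℕ → ℕ) → ℕ → ℕ
properPartSum g k = partSum g k ∸ g k

partSum-split : ∀ g k → partSum g k ≡ g k + properPartSum g k
partSum-split g k = sym (m+[n∸m]≡n (≤-partSum g k))

-- strictChains j k counts the chains of j successive non-discrete partitions starting
-- from a k-set, and tailChains n j m = G(j, m) counts the elements of ℘_n^{(m+1+j)}
-- whose last j partitions are all non-discrete.
strictChains : ℕ → ℕ → ℕ
strictChains zero _ = 1
strictChains (suc j) k = properPartSum (strictChains j) k

strictChains-vanish : ∀ {j k} → k ℕ.< j → strictChains j k ≡ 0
strictChains-vanish {suc j} {k} (s≤s k≤j) =
  m≤n⇒m∸n≡0 (partSum-≤ (strictChains j) k (λ x x<k → strictChains-vanish (≤-trans x<k k≤j)))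

tailChains : ℕ → ℕ → ℕ → ℕ
tailChains n j m = chainSum n m (strictChains j)

tailChains-suc : ∀ n j m → tailChains n j (suc m) ≡ tailChains n j m + tailChains n (suc j) m
tailChains-suc n j m = trans (chainSum-suc n m (strictChains j))
  (trans (∑-cong (λ c → partSum-split (strictChains j) (card c)) (℘ n (suc m)))
         (∑-distrib-+ (strictChains j ∘ card) (strictChains (suc j) ∘ card) (℘ n (suc m))))

tailChains-vanish : ∀ N m → tailChains (suc N) (suc (suc N)) m ≡ 0
tailChains-vanish N m =
  trans (chainSum-cong N m {h = λ _ → 0} (λ y _ y≤N → strictChains-vanish (s≤s y≤N)))
        (∑-zero (℘ (suc N) (suc m)))

module _ (G : ℕ → ℕ → ℕ) (n : ℕ)
         (G-suc : ∀ j m → G j (suc m) ≡ G j m + G (suc j) m)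
         (G-vanish : ∀ m → G (suc n) m ≡ 0) where

  -- Unfolded, G j m = Σᵢ C(m, i) G (j + i) 0 with only i ≤ n - j contributing, and
  -- m C(m, i) ≤ (i + 1) C(m + 1, i + 1) ≤ d C(m + 1, i + 1); the induction on d and m
  -- below runs this comparison through the recurrence alone.
  pascal-bound : ∀ d j → d + j ≡ n → ∀ m → m * G (suc j) m ≤ d * G j (suc m)
  pascal-bound zero j refl m = ≤-reflexive (trans (cong (m *_) (G-vanish m)) (*-zeroʳ m))
  pascal-bound (suc d) j _ zero = z≤n
  pascal-bound (suc d) j d+j≡n (suc m) = begin
    suc m * b                                       ≡⟨ cong (λ z → b + m * z) (G-suc (suc j) m) ⟩
    b + m * (G (suc j) m + G (suc (suc j)) m)       ≡⟨ cong (b +_) (*-distribˡ-+ m _ _) ⟩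
    b + (m * G (suc j) m + m * G (suc (suc j)) m)
      ≤⟨ +-monoʳ-≤ b (+-mono-≤ (pascal-bound (suc d) j d+j≡n m)
                               (pascal-bound d (suc j) (trans (+-suc d j) d+j≡n) m)) ⟩
    b + (suc d * a + d * b)                         ≡⟨ regroup a b d ⟩
    suc d * (a + b)                                 ≡⟨ cong (suc d *_) (G-suc j (suc m)) ⟨
    suc d * G j (suc (suc m))                       ∎
    where
    open ≤-Reasoning
    a b : ℕ
    a = G j (suc m)
    b = G (suc j) (suc m)
    regroup : ∀ a b d → b + (suc d * a + d * b) ≡ suc d * (a + b)
    regroup = solve-∀

tailChains-growth : ∀ N m → m * tailChains (suc N) 1 m ≤ suc N * tailChains (suc N) 0 (suc m)
tailChains-growth N =
  pascal-bound (tailChains (suc N)) (suc N) (tailChains-suc (suc N)) (tailChains-vanish N)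
               (suc N) 0 (+-identityʳ (suc N))

excess : ℕ → ℕ → ℕ
excess n m = chainSum n m (_∸ 1)

B≡tailChains : ∀ n m → B (suc m) n ≡ tailChains n 0 m
B≡tailChains n m = length≡∑1 (℘ n (suc m))

1≤B : ∀ n m → 1 ≤ B (suc m) n
1≤B n m = subst (1 ≤_) (sym (B≡tailChains n m)) (≤-chainSum n m (λ _ → 1))

excess≤tailChains : ∀ n m → excess n m ≤ tailChains n 1 m
excess≤tailChains n m = ∑-mono-≤ (λ c → ∸-monoˡ-≤ 1 (n≤bell (card c))) (℘ n (suc m))

weighted≡B+excess : ∀ N m → weighted (suc m) (suc N) ≡ B (suc m) (suc N) + excess (suc N) m
weighted≡B+excess N m = begin
  weighted (suc m) n
    ≡⟨ ∑-cong (λ k → cong (k *_) (length-filter≡∑δ card k L)) K ⟩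
  ∑ (λ k → k * ∑ (λ c → δ (card c) k) L) K
    ≡⟨ ∑-cong (λ k → ∑-*-distribˡ k (λ c → δ (card c) k) L) K ⟨
  ∑ (λ k → ∑ (λ c → k * δ (card c) k) L) K
    ≡⟨ ∑-comm (λ k c → k * δ (card c) k) K L ⟩
  chainSum n m (λ x → ∑ (λ k → k * δ x k) K)
    ≡⟨ chainSum-cong N m (λ x 1≤x x≤n → trans (∑-*-δ 1≤x x≤n) (sym (m+[n∸m]≡n 1≤x))) ⟩
  chainSum n m (λ x → 1 + (x ∸ 1))
    ≡⟨ ∑-distrib-+ (λ _ → 1) (λ c → card c ∸ 1) L ⟩
  ∑ (λ _ → 1) L + excess n m
    ≡⟨ cong (_+ excess n m) (length≡∑1 L) ⟨
  B (suc m) n + excess n m ∎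
  where
  open ≡-Reasoning
  n : ℕ
  n = suc N
  L : List Chain
  L = ℘ n (suc m)
  K : List ℕ
  K = map suc (upTo n)

mD≤n[B+D]⇒[1+q]D≤B : ∀ n m q D B → .{{_ : ℕ.NonZero n}} →
  n + n * suc q ≤ m → m * D ≤ n * (B + D) → suc q * D ≤ B
mD≤n[B+D]⇒[1+q]D≤B n m q D B n+n[1+q]≤m mD≤n[B+D] =
  *-cancelˡ-≤ n (+-cancelˡ-≤ (n * D) _ _ (begin
    n * D + n * (suc q * D) ≡⟨ cong (n * D +_) (*-assoc n (suc q) D) ⟨
    n * D + n * suc q * D   ≡⟨ *-distribʳ-+ D n (n * suc q) ⟨
    (n + n * suc q) * D     ≤⟨ *-monoˡ-≤ D n+n[1+q]≤m ⟩
    m * D                   ≤⟨ mD≤n[B+D] ⟩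
    n * (B + D)             ≡⟨ *-distribˡ-+ n B D ⟩
    n * B + n * D           ≡⟨ +-comm (n * B) (n * D) ⟩
    n * D + n * B           ∎))
  where open ≤-Reasoning

[1+q]D≤B⇒qD<B : ∀ q D {B} → 0 ℕ.< B → suc q * D ≤ B → q * D ℕ.< B
[1+q]D≤B⇒qD<B q zero {B} 0<B _ = subst (ℕ._< B) (sym (*-zeroʳ q)) 0<B
[1+q]D≤B⇒qD<B q (suc D) _ [1+q][1+D]≤B = <-≤-trans (m<n+m (q * suc D) z<s) [1+q][1+D]≤B

excess*q<B : ∀ N q m → suc N + suc N * suc q ≤ m → excess (suc N) m * q ℕ.< B (suc m) (suc N)
excess*q<B N q m large = begin-strict
  excess n m * q ≤⟨ *-monoˡ-≤ q (excess≤tailChains n m) ⟩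
  D * q          ≡⟨ *-comm D q ⟩
  q * D          <⟨ [1+q]D≤B⇒qD<B q D (1≤B n m) [1+q]D≤B ⟩
  B (suc m) n    ∎
  where
  open ≤-Reasoning
  n D : ℕ
  n = suc N
  D = tailChains n 1 m
  growth : m * D ≤ n * (B (suc m) n + D)
  growth = begin
    m * D                      ≤⟨ tailChains-growth N m ⟩
    n * tailChains n 0 (suc m) ≡⟨ cong (n *_) (tailChains-suc n 0 m) ⟩
    n * (tailChains n 0 m + D) ≡⟨ cong (λ B′ → n * (B′ + D)) (B≡tailChains n m) ⟨
    n * (B (suc m) n + D)      ∎
  [1+q]D≤B : suc q * D ≤ B (suc m) n
  [1+q]D≤B = mD≤n[B+D]⇒[1+q]D≤B n m q D (B (suc m) n) large growth

toℚᵘ-[b+t]/b-1 : ∀ b t → toℚᵘ ((ℤ.+ (suc b + t)) ℚ./ suc b - 1ℚ) ≃ mkℚᵘ (ℤ.+ t) b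
toℚᵘ-[b+t]/b-1 b t =
  ≃-trans (toℚᵘ-homo-+ ((ℤ.+ (suc b + t)) ℚ./ suc b) (ℚ.- 1ℚ))
    (≃-trans (+-cong (toℚᵘ-fromℚᵘ (mkℚᵘ (ℤ.+ (suc b + t)) b)) (toℚᵘ-homo‿- 1ℚ)) (*≡* cross-multiplied))
  where
  ring-identity : ∀ s t → ((s ℤ.+ t) ℤ.* ℤ.+ 1 ℤ.+ -[1+ 0 ] ℤ.* s) ℤ.* s ≡ t ℤ.* (s ℤ.* ℤ.+ 1)
  ring-identity = ℤ-Solver.solve-∀
  cross-multiplied : (ℤ.+ (suc b + t) ℤ.* ℤ.+ 1 ℤ.+ -[1+ 0 ] ℤ.* ℤ.+ suc b) ℤ.* ℤ.+ suc b
                     ≡ ℤ.+ t ℤ.* (ℤ.+ suc b ℤ.* ℤ.+ 1)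
  cross-multiplied rewrite pos-+ (suc b) t = ring-identity (ℤ.+ suc b) (ℤ.+ t)

[b+t]/b-1≡t/b : ∀ b t → (ℤ.+ (suc b + t)) ℚ./ suc b - 1ℚ ≡ (ℤ.+ t) ℚ./ suc b
[b+t]/b-1≡t/b b t =
  toℚᵘ-injective (≃-trans (toℚᵘ-[b+t]/b-1 b t) (≃-sym (toℚᵘ-fromℚᵘ (mkℚᵘ (ℤ.+ t) b))))

∣t/b∣≡t/b : ∀ t b → ∣ (ℤ.+ t) ℚ./ suc b ∣ ≡ (ℤ.+ t) ℚ./ suc b
∣t/b∣≡t/b t b = 0≤p⇒∣p∣≡p (nonNegative⁻¹ _ {{normalize-nonNeg t (suc b)}})

∣A-1∣≡excess/B : ∀ m n b t → B m n ≡ suc b → weighted m n ≡ suc b + t →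
  ∣ A m n - 1ℚ ∣ ≡ (ℤ.+ t) ℚ./ suc b
∣A-1∣≡excess/B m n b t B≡1+b w≡b+t rewrite B≡1+b | w≡b+t =
  trans (cong ∣_∣ ([b+t]/b-1≡t/b b t)) (∣t/b∣≡t/b t b)

archimedean : ∀ ε → 0ℚ < ε → ∃ λ q → ∀ t b → t * q ℕ.< suc b → (ℤ.+ t) ℚ./ suc b < ε
archimedean (mkℚ (ℤ.+ zero) _ _) (*<* (+<+ ()))
archimedean (mkℚ -[1+ _ ] _ _) (*<* ())
archimedean (mkℚ (ℤ.+ suc p) d _) _ = suc d , t/b<ε
  where
  t/b<ε : ∀ t b → t * suc d ℕ.< suc b → (ℤ.+ t) ℚ./ suc b < mkℚ (ℤ.+ suc p) d _
  t/b<ε t b t[1+d]<1+b = toℚᵘ-cancel-< (<-respˡ-≃ (≃-sym (toℚᵘ-fromℚᵘ (mkℚᵘ (ℤ.+ t) b)))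
    (ℚᵘ.*<* (subst₂ ℤ._<_ (pos-* t (suc d)) (pos-* (suc p) (suc b))
      (+<+ (<-≤-trans t[1+d]<1+b (m≤n*m (suc b) (suc p)))))))

mainTheorem3 : (n : ℕ) → 1 ≤ n → (ε : ℚ) → 0ℚ < ε →
    ∃ λ M → (m : ℕ) → 1 ≤ m → M ≤ m → ∣ A m n - 1ℚ ∣ < ε
mainTheorem3 zero ()
mainTheorem3 (suc N) _ ε 0<ε with archimedean ε 0<ε
... | q , small = suc (n + n * suc q) , close
  where
  n : ℕ
  n = suc N
  close : (m : ℕ) → 1 ≤ m → suc (n + n * suc q) ≤ m → ∣ A m n - 1ℚ ∣ < ε
  close (suc m) _ (s≤s large) =
    subst (_< ε) (sym (∣A-1∣≡excess/B (suc m) n b T B≡1+b weighted≡1+b+T))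
      (small T b (subst (T * q ℕ.<_) B≡1+b (excess*q<B N q m large)))
    where
    T b : ℕ
    T = excess n m
    b = pred (B (suc m) n)
    B≡1+b : B (suc m) n ≡ suc b
    B≡1+b = sym (suc-pred (B (suc m) n) {{ℕ.>-nonZero (1≤B n m)}})
    weighted≡1+b+T : weighted (suc m) n ≡ suc b + T
    weighted≡1+b+T = trans (weighted≡B+excess N m) (cong (_+ T) B≡1+b)
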